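{- Let $T$ be a complete theory with monster model $\mathbb{M}$ and let $\varphi(x,y)$ be a partitioned formula which is not NIP. Then the partitioned formula $\psi(x;y_1,y_2):=\varphi(x,y_1)\wedge\neg\varphi(x,y_2)$ is not pierceable.
   Context: $\varphi(x,y)$ has the independence property (IP) if there is an infinite set $A\subseteq\mathbb{M}^y$ such that for every $I\subseteq A$ there is $b_I\in\mathbb{M}^x$ with $\models\varphi(b_I,a)\iff a\in I$ for all $a\in A$; it is NIP otherwise. A family $\mathcal{F}$ of sets satisfies the $(p,q)$-property ($p\geq q$) if for every tuple $(S_1,\dots,S_p)$ of members of $\mathcal{F}$ (repetitions allowed) there is $I\subseteq[p]$, $|I|=q$, with $\bigcap_{i\in I}S_i\neq\emptyset$. A partitioned formula $\psi(x,z)$ is $d$-pierceable if for all $p\geq q\geq d$ there is $N=N(p,q)\in\omega$ such that every finite subfamily $\mathcal{F}'$ of $\{\psi(\mathbb{M},c):c\in\mathbb{M}^z\}$ satisfying the $(p,q)$-property admits a transversal of size at most $N$ (a set of at most $N$ points meeting every member of $\mathcal{F}'$). It is pierceable if it is $d$-pierceable for some $d\in\omega$. -}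

module Defs where

open import Data.Nat using (ℕ; _≤_; _≥_)
open import Data.Fin using (Fin)
open import Data.Fin.Subset using (Subset; ∣_∣) renaming (_∈_ to _∈ₛ_)
open import Data.List using (List; length)
open import Data.List.Membership.Propositional using (_∈_)
open import Data.List.Relation.Unary.All using (All)
open import Data.List.Relation.Unary.Any using (Any)
open import Data.Product using (Σ; _×_; _,_)
open import Relation.Nullary using (¬_)
open import Relation.Binary.PropositionalEquality using (_≡_)
open import Function.Bundles using (_⇔_)
open import Function.Definitions using (Injective)

-- A partitioned formula φ(x,y) is represented by the relation it defines on
-- the monster model: X plays the role of 𝕄^x, Y of 𝕄^y, and φ b a means ⊨ φ(b,a).

-- Independence property: an infinite set A ⊆ 𝕄^y (given as an injective
-- enumeration a : ℕ → Y) such that every subset I ⊆ A (a predicate on indices)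
-- is cut out by some b_I.
IP : {X Y : Set} → (X → Y → Set) → Set₁
IP {X} {Y} φ =
  Σ (ℕ → Y) λ a → Injective _≡_ _≡_ a ×
    ((I : ℕ → Set) → Σ X λ b → ∀ n → (φ b (a n) ⇔ I n))

NIP : {X Y : Set} → (X → Y → Set) → Set₁
NIP φ = ¬ IP φ

ψ-of : {X Y : Set} → (X → Y → Set) → X → Y × Y → Set
ψ-of φ x (c₁ , c₂) = φ x c₁ × ¬ φ x c₂

-- A finite subfamily of {ψ(𝕄,c) : c ∈ Z} is given by a finite list of parameters.
-- (p,q)-property: every p-tuple of members (repetitions allowed) has q members
-- (q distinct indices) with a common point.
PQProperty : {X Z : Set} → (X → Z → Set) → ℕ → ℕ → List Z → Set
PQProperty {X} {Z} ψ p q F =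
  (S : Fin p → Z) → (∀ i → S i ∈ F) →
    Σ (Subset p) λ I → ∣ I ∣ ≡ q × Σ X λ x → ∀ i → i ∈ₛ I → ψ x (S i)

HasTransversal : {X Z : Set} → (X → Z → Set) → ℕ → List Z → Set
HasTransversal {X} ψ N F =
  Σ (List X) λ T → length T ≤ N × All (λ c → Any (λ x → ψ x c) T) F

Pierceable-d : {X Z : Set} → (X → Z → Set) → ℕ → Set
Pierceable-d ψ d =
  ∀ p q → p ≥ q → q ≥ d →
    Σ ℕ λ N → ∀ (F : List _) → PQProperty ψ p q F → HasTransversal ψ N F

Pierceable : {X Z : Set} → (X → Z → Set) → Set
Pierceable ψ = Σ ℕ λ d → Pierceable-d ψ d

-- Let a₀, a₁, … be a sequence shattered by φ and F_M the family of the sets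
-- ψ(𝕄; aᵢ, aⱼ) with i < j < M.  A transversal T of F_M separates every pair of
-- the sequence (some x ∈ T satisfies φ(x,aᵢ) but not φ(x,aⱼ)), so the aᵢ have
-- pairwise distinct φ-types over T and M ≤ 2^|T|.  On the other hand, among any
-- d² members ψ(𝕄; a_{tₖ}, a_{hₖ}) one finds d in which no head hₖ equals a tail
-- tₘ; shattering then gives a point in a_{tₘ} for every tail and outside a_{hₖ}
-- for every head.  So every F_M has the (d², d)-property, and no N bounds the
-- size of transversals.
module Submission where

open import Defs
open import Relation.Nullary using (¬_)
open import Data.Nat using (ℕ; zero; suc; _+_; _*_; _^_; _≤_; _<_; z≤n; s≤s)
open import Data.Nat.Properties
open import Data.Fin using (Fin; zero; suc)
open import Data.Fin.Subset using (Subset; ∣_∣; inside; outside) renaming (_∈_ to _∈ₛ_; _∉_ to _∉ₛ_; ⊥ to ∅)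
open import Data.Fin.Subset.Properties using (∉⊥; ∣⊥∣≡0)
open import Data.Vec using (_∷_; _[_]≔_)
open import Data.Vec.Base using (here; there)
open import Data.List using (List; []; _∷_; length; map; _++_; filter; take; applyUpTo; allFin)
open import Data.List.Properties using (length-take; length-applyUpTo; length-tabulate)
open import Data.List.Membership.Propositional using (_∈_; find)
open import Data.List.Membership.Propositional.Properties using (∈-filter⁻)
open import Data.List.Relation.Unary.Any as Any using (Any; here; there)
open import Data.List.Relation.Unary.All as All using (All; []; _∷_)
open import Data.List.Relation.Unary.All.Properties using (++⁺; ++⁻; map⁺; map⁻)
open import Data.List.Relation.Unary.AllPairs using (AllPairs; []; _∷_)
open import Data.List.Relation.Unary.AllPairs.Properties using (applyUpTo⁺₁)
open import Data.List.Relation.Unary.Unique.Propositional using (Unique)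
import Data.List.Relation.Unary.Unique.Propositional.Properties as Unique
open import Data.List.Relation.Binary.Subset.Propositional using (_⊆_)
open import Data.List.Relation.Binary.Subset.Propositional.Properties using (filter-⊆)
open import Data.List.Relation.Binary.Sublist.Propositional using ([]; _∷_; _∷ʳ_) renaming (_⊆_ to _⊑_)
open import Data.List.Relation.Binary.Sublist.Propositional.Properties using (All-resp-⊆; Any-resp-⊆; take-⊆)
open import Data.List.Extrema.Nat using (argmin; argmin-all; f[argmin]≤f[⊤]; f[argmin]≤f[xs])
open import Data.Product using (Σ; _×_; _,_; proj₁; proj₂; uncurry)
open import Data.Sum as Sum using (_⊎_; inj₁; inj₂; [_,_]′)
open import Function using (_∘_; id)
open import Function.Bundles using (Equivalence; _⇔_)
open import Relation.Nullary using (Dec; yes; no; contradiction; ¬¬-excluded-middle)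
open import Relation.Unary using (Decidable)
open import Relation.Unary.Properties using (∁?)
open import Relation.Binary.PropositionalEquality using (_≡_; _≢_; refl; sym; trans; cong; subst)

private
  variable
    A X Y : Set

m≤m*m : ∀ m → m ≤ m * m
m≤m*m zero    = z≤n
m≤m*m (suc m) = m≤m*n (suc m) (suc m)

2*m<a+b⇒m<a⊎m<b : ∀ m a b → 2 * m < a + b → m < a ⊎ m < b
2*m<a+b⇒m<a⊎m<b m a b m+m<a+b with m <? a | m <? b
... | yes m<a | _       = inj₁ m<a
... | no _    | yes m<b = inj₂ m<b
... | no m≮a  | no m≮b  =
  contradiction m+m<a+b (≤⇒≯ (+-mono-≤ (≮⇒≥ m≮a) (subst (b ≤_) (sym (+-identityʳ m)) (≮⇒≥ m≮b))))

square-suc-bound : ∀ q a b c → suc q * suc q ≤ a + (b + c) → a ≤ q → b ≤ q → q * q ≤ c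
square-suc-bound q a b c big a≤q b≤q = +-cancelˡ-≤ q _ _ (+-cancelˡ-≤ q _ _ (<⇒≤ (begin-strict
  q + (q + q * q)        <⟨ n<1+n _ ⟩
  suc (q + (q + q * q))  ≡⟨ cong (λ n → suc (q + n)) (sym (*-suc q q)) ⟩
  suc q * suc q          ≤⟨ big ⟩
  a + (b + c)            ≤⟨ +-mono-≤ a≤q (+-monoˡ-≤ c b≤q) ⟩
  q + (q + c)            ∎)))
  where open ≤-Reasoning

length-filter+filter∁ : ∀ {P : A → Set} (P? : Decidable P) xs →
  length (filter P? xs) + length (filter (∁? P?) xs) ≡ length xs
length-filter+filter∁ P? [] = refl
length-filter+filter∁ P? (x ∷ xs) with P? x
... | yes _ = cong suc (length-filter+filter∁ P? xs)
... | no _  = trans (+-suc _ _) (cong suc (length-filter+filter∁ P? xs))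

AllPairs-resp-⊑ : ∀ {R : A → A → Set} {xs ys} → xs ⊑ ys → AllPairs R ys → AllPairs R xs
AllPairs-resp-⊑ []           []       = []
AllPairs-resp-⊑ (_ ∷ʳ xs⊑)   (_ ∷ rs) = AllPairs-resp-⊑ xs⊑ rs
AllPairs-resp-⊑ (refl ∷ xs⊑) (r ∷ rs) = All-resp-⊆ xs⊑ r ∷ AllPairs-resp-⊑ xs⊑ rs

AllPairs-mapWithAll : ∀ {P : A → Set} {R S : A → A → Set} {xs} →
  (∀ {x y} → P x → P y → R x y → S x y) → All P xs → AllPairs R xs → AllPairs S xs
AllPairs-mapWithAll f []         []       = []
AllPairs-mapWithAll f (px ∷ pxs) (r ∷ rs) =
  All.zipWith (λ (py , rxy) → f px py rxy) (pxs , r) ∷ AllPairs-mapWithAll f pxs rs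

pairs : List A → List (A × A)
pairs []       = []
pairs (x ∷ xs) = map (x ,_) xs ++ pairs xs

All-pairs⁺ : ∀ {R : A → A → Set} {xs} → AllPairs R xs → All (uncurry R) (pairs xs)
All-pairs⁺ []       = []
All-pairs⁺ (r ∷ rs) = ++⁺ (map⁺ r) (All-pairs⁺ rs)

All-pairs⁻ : ∀ (R : A → A → Set) {xs} → All (uncurry R) (pairs xs) → AllPairs R xs
All-pairs⁻ R {[]}     _ = []
All-pairs⁻ R {x ∷ xs} rs with ++⁻ (map (x ,_) xs) rs
... | rx , rest = map⁻ rx ∷ All-pairs⁻ R rest

-- Partitioning a list along decisions of P made element by element, which is
-- all a classical argument can provide when P itself is undecidable.
module _ {P : A → Set} where

  ¬¬-decideAll : ∀ xs → ¬ ¬ All (Dec ∘ P) xs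
  ¬¬-decideAll []       k = k []
  ¬¬-decideAll (x ∷ xs) k = ¬¬-excluded-middle λ d → ¬¬-decideAll xs λ ds → k (d ∷ ds)

  accepted rejected : ∀ {xs} → All (Dec ∘ P) xs → List A
  accepted []                    = []
  accepted {x ∷ _} (yes _ ∷ ds) = x ∷ accepted ds
  accepted         (no _  ∷ ds) = accepted ds
  rejected []                    = []
  rejected         (yes _ ∷ ds) = rejected ds
  rejected {x ∷ _} (no _  ∷ ds) = x ∷ rejected ds

  All-accepted : ∀ {xs} (ds : All (Dec ∘ P) xs) → All P (accepted ds)
  All-accepted []            = []
  All-accepted (yes p ∷ ds) = p ∷ All-accepted ds
  All-accepted (no _  ∷ ds) = All-accepted ds

  All-rejected : ∀ {xs} (ds : All (Dec ∘ P) xs) → All (¬_ ∘ P) (rejected ds)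
  All-rejected []            = []
  All-rejected (yes _ ∷ ds) = All-rejected ds
  All-rejected (no ¬p ∷ ds) = ¬p ∷ All-rejected ds

  accepted-⊑ : ∀ {xs} (ds : All (Dec ∘ P) xs) → accepted ds ⊑ xs
  accepted-⊑ []            = []
  accepted-⊑ (yes _ ∷ ds) = refl ∷ accepted-⊑ ds
  accepted-⊑ (no _  ∷ ds) = _ ∷ʳ accepted-⊑ ds

  rejected-⊑ : ∀ {xs} (ds : All (Dec ∘ P) xs) → rejected ds ⊑ xs
  rejected-⊑ []            = []
  rejected-⊑ (yes _ ∷ ds) = _ ∷ʳ rejected-⊑ ds
  rejected-⊑ (no _  ∷ ds) = refl ∷ rejected-⊑ ds

  length-accepted+rejected : ∀ {xs} (ds : All (Dec ∘ P) xs) →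
    length (accepted ds) + length (rejected ds) ≡ length xs
  length-accepted+rejected []            = refl
  length-accepted+rejected (yes _ ∷ ds) = cong suc (length-accepted+rejected ds)
  length-accepted+rejected (no _  ∷ ds) =
    trans (+-suc _ _) (cong suc (length-accepted+rejected ds))

module Separation (φ : X → Y → Set) where

  Separated : List X → Y → Y → Set
  Separated T y y′ = Any (λ x → ψ-of φ x (y , y′)) T

  -- Splitting ys by the first point x of T, each half is separated by the
  -- rest of T, and one half is longer than 2 ^ length T.
  separated-length : ∀ T ys → AllPairs (Separated T) ys → ¬ 2 ^ length T < length ys
  separated-length []      []          _                 ()
  separated-length []      (_ ∷ [])    _                 (s≤s ())
  separated-length []      (_ ∷ _ ∷ _) ((() ∷ _) ∷ _)    _
  separated-length (x ∷ T) ys          sep               long = ¬¬-decideAll ys λ ds →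
    [ separated-length T (accepted ds)
        (AllPairs-mapWithAll drop-accepted (All-accepted ds) (AllPairs-resp-⊑ (accepted-⊑ ds) sep))
    , separated-length T (rejected ds)
        (AllPairs-mapWithAll drop-rejected (All-rejected ds) (AllPairs-resp-⊑ (rejected-⊑ ds) sep))
    ]′ (2*m<a+b⇒m<a⊎m<b _ _ _ (subst (2 ^ length (x ∷ T) <_) (sym (length-accepted+rejected ds)) long))
    where
    drop-accepted : ∀ {y y′} → φ x y → φ x y′ → Separated (x ∷ T) y y′ → Separated T y y′
    drop-accepted _ φy′ (here (_ , ¬φy′)) = contradiction φy′ ¬φy′
    drop-accepted _ _   (there s)        = s
    drop-rejected : ∀ {y y′} → ¬ φ x y → ¬ φ x y′ → Separated (x ∷ T) y y′ → Separated T y y′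
    drop-rejected ¬φy _ (here (φy , _)) = contradiction φy ¬φy
    drop-rejected _   _ (there s)       = s

  no-small-transversal : ∀ (a : ℕ → Y) N →
    ¬ HasTransversal (ψ-of φ) N (pairs (applyUpTo a (suc (2 ^ N))))
  no-small-transversal a N (T , |T|≤N , covers) =
    separated-length T ys (All-pairs⁻ (Separated T) covers) (begin-strict
      2 ^ length T   ≤⟨ ^-monoʳ-≤ 2 |T|≤N ⟩
      2 ^ N          <⟨ n<1+n _ ⟩
      suc (2 ^ N)    ≡⟨ sym (length-applyUpTo a _) ⟩
      length ys      ∎)
    where
    open ≤-Reasoning
    ys = applyUpTo a (suc (2 ^ N))

toSubset : ∀ {n} → List (Fin n) → Subset n
toSubset []      = ∅
toSubset (x ∷ L) = toSubset L [ x ]≔ inside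

∈-[]≔inside⁻ : ∀ {n} {x y : Fin n} (p : Subset n) → y ∈ₛ p [ x ]≔ inside → y ≡ x ⊎ y ∈ₛ p
∈-[]≔inside⁻ {x = zero}  {zero}  (_ ∷ p) here       = inj₁ refl
∈-[]≔inside⁻ {x = zero}  {suc y} (_ ∷ p) (there y∈) = inj₂ (there y∈)
∈-[]≔inside⁻ {x = suc x} {zero}  (_ ∷ p) here       = inj₂ here
∈-[]≔inside⁻ {x = suc x} {suc y} (_ ∷ p) (there y∈) = Sum.map (cong suc) there (∈-[]≔inside⁻ p y∈)

∣[]≔inside∣ : ∀ {n} {x : Fin n} (p : Subset n) → x ∉ₛ p → ∣ p [ x ]≔ inside ∣ ≡ suc ∣ p ∣
∣[]≔inside∣ {x = zero}  (inside  ∷ p) x∉ = contradiction here x∉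
∣[]≔inside∣ {x = zero}  (outside ∷ p) x∉ = refl
∣[]≔inside∣ {x = suc x} (inside  ∷ p) x∉ = cong suc (∣[]≔inside∣ p (x∉ ∘ there))
∣[]≔inside∣ {x = suc x} (outside ∷ p) x∉ = ∣[]≔inside∣ p (x∉ ∘ there)

∈-toSubset⁻ : ∀ {n} (L : List (Fin n)) {k} → k ∈ₛ toSubset L → k ∈ L
∈-toSubset⁻ []      k∈ = contradiction k∈ ∉⊥
∈-toSubset⁻ (x ∷ L) k∈ = [ here , there ∘ ∈-toSubset⁻ L ]′ (∈-[]≔inside⁻ (toSubset L) k∈)

∣toSubset∣ : ∀ {n} {L : List (Fin n)} → Unique L → ∣ toSubset L ∣ ≡ length L
∣toSubset∣ {n} {[]}        []          = ∣⊥∣≡0 n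
∣toSubset∣ {L = x ∷ L} (x∉L ∷ uL) =
  trans (∣[]≔inside∣ (toSubset L) λ x∈ → All.lookup x∉L (∈-toSubset⁻ L x∈) refl) (cong suc (∣toSubset∣ uL))

-- An index k stands for the interval [t k, h k); we look for many intervals
-- none of which ends where another one starts.
module Intervals (t h : A → ℕ) where

  Nonabutting : List A → Set
  Nonabutting L = ∀ {k m} → k ∈ L → m ∈ L → t m ≢ h k

  record Choice (q : ℕ) (E : List A) : Set where
    constructor choice
    field
      chosen      : List A
      unique      : Unique chosen
      chosen⊆     : chosen ⊆ E
      length≡     : length chosen ≡ q
      nonabutting : Nonabutting chosen

  truncate : ∀ {q E L} → Unique L → L ⊆ E → q ≤ length L → Nonabutting L → Choice q E
  truncate {q} {L = L} uL L⊆E q≤ nL =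
    choice (take q L) (Unique.take⁺ q uL) (L⊆E ∘ take⊆) (trans (length-take q L) (m≤n⇒m⊓n≡m q≤))
      (λ k∈ m∈ → nL (take⊆ k∈) (take⊆ m∈))
    where
    take⊆ : take q L ⊆ L
    take⊆ = Any-resp-⊆ (take-⊆ q L)

  starting-below-nonabutting : ∀ {E} h₀ → (∀ {k} → k ∈ E → h₀ ≤ h k) →
    Nonabutting (filter (λ k → t k <? h₀) E)
  starting-below-nonabutting {E} h₀ least k∈ m∈ tm≡hk
    with ∈-filter⁻ (λ k → t k <? h₀) {xs = E} k∈ | ∈-filter⁻ (λ k → t k <? h₀) {xs = E} m∈
  ... | k∈E , _ | _ , tm<h₀ = <⇒≱ tm<h₀ (subst (h₀ ≤_) (sym tm≡hk) (least k∈E))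

  starting-at-nonabutting : (∀ k → t k < h k) → ∀ {E} h₀ → Nonabutting (filter (λ k → t k ≟ h₀) E)
  starting-at-nonabutting t<h {E} h₀ {k} k∈ m∈ tm≡hk
    with ∈-filter⁻ (λ k → t k ≟ h₀) {xs = E} k∈ | ∈-filter⁻ (λ k → t k ≟ h₀) {xs = E} m∈
  ... | _ , tk≡h₀ | _ , tm≡h₀ = <-irrefl (trans tk≡h₀ (trans (sym tm≡h₀) tm≡hk)) (t<h k)

  cons-choice : (∀ k → t k < h k) → ∀ {e q B E} → e ∈ E → B ⊆ E → (∀ {k} → k ∈ B → h e < t k) →
    Choice q B → Choice (suc q) E
  cons-choice t<h {e} {E = E} e∈E B⊆E after (choice L uL L⊆B |L|≡q nL) =
    choice (e ∷ L) (All.tabulate e≢ ∷ uL) e∷L⊆E (cong suc |L|≡q) nonabutting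
    where
    e≢ : ∀ {k} → k ∈ L → e ≢ k
    e≢ k∈ refl = <-asym (t<h e) (after (L⊆B k∈))
    e∷L⊆E : e ∷ L ⊆ E
    e∷L⊆E (here refl) = e∈E
    e∷L⊆E (there k∈)  = B⊆E (L⊆B k∈)
    nonabutting : Nonabutting (e ∷ L)
    nonabutting (here refl) (here refl) te≡he = <-irrefl te≡he (t<h e)
    nonabutting (here refl) (there m∈)  tm≡he = <-irrefl (sym tm≡he) (after (L⊆B m∈))
    nonabutting {k} (there k∈) (here refl) te≡hk =
      <-irrefl te≡hk (<-trans (t<h e) (<-trans (after (L⊆B k∈)) (t<h k)))
    nonabutting (there k∈)  (there m∈)  = nL k∈ m∈

  -- Take e with least head h₀ and sort the intervals by whether they start
  -- below, at or above h₀.  The first two groups are nonabutting by themselves;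
  -- if both are small, the third is large and e can be put in front of it.
  choose-around-least : (∀ k → t k < h k) → ∀ {q E} → Unique E → suc q * suc q ≤ length E →
    (∀ {B} → Unique B → q * q ≤ length B → Choice q B) →
    ∀ {e} → e ∈ E → (∀ {k} → k ∈ E → h e ≤ h k) → Choice (suc q) E
  choose-around-least t<h {q} {E} uE big choose-q {e} e∈E least =
    pick (suc q ≤? length below) (suc q ≤? length at)
    where
    h₀ = h e
    below? = λ k → t k <? h₀
    at? = λ k → t k ≟ h₀
    below = filter below? E
    notBelow = filter (∁? below?) E
    at = filter at? notBelow
    above = filter (∁? at?) notBelow
    above⊆E : above ⊆ E
    above⊆E = filter-⊆ (∁? below?) E ∘ filter-⊆ (∁? at?) notBelow
    h₀<above : ∀ {k} → k ∈ above → h₀ < t k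
    h₀<above k∈ with ∈-filter⁻ (∁? at?) {xs = notBelow} k∈
    ... | k∈nb , tk≢h₀ = ≤∧≢⇒< (≮⇒≥ (proj₂ (∈-filter⁻ (∁? below?) {xs = E} k∈nb))) (tk≢h₀ ∘ sym)
    length-E : length E ≡ length below + (length at + length above)
    length-E = sym (trans (cong (length below +_) (length-filter+filter∁ at? notBelow))
                          (length-filter+filter∁ below? E))
    pick : Dec (suc q ≤ length below) → Dec (suc q ≤ length at) → Choice (suc q) E
    pick (yes many) _ =
      truncate (Unique.filter⁺ below? uE) (filter-⊆ below? E) many (starting-below-nonabutting h₀ least)
    pick (no _) (yes many) =
      truncate (Unique.filter⁺ at? (Unique.filter⁺ (∁? below?) uE))
        (filter-⊆ (∁? below?) E ∘ filter-⊆ at? notBelow) many (starting-at-nonabutting t<h {notBelow} h₀)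
    pick (no few₁) (no few₂) =
      cons-choice t<h e∈E above⊆E h₀<above
        (choose-q (Unique.filter⁺ (∁? at?) (Unique.filter⁺ (∁? below?) uE))
          (square-suc-bound q _ _ _ (subst (suc q * suc q ≤_) length-E big)
            (≤-pred (≰⇒> few₁)) (≤-pred (≰⇒> few₂))))

  choose : (∀ k → t k < h k) → ∀ q E → Unique E → q * q ≤ length E → Choice q E
  choose t<h zero    E        _  _   = choice [] [] (λ ()) refl (λ ())
  choose t<h (suc q) (x ∷ xs) uE big =
    choose-around-least t<h uE big (choose t<h q _)
      (argmin-all h {P = _∈ x ∷ xs} (here refl) (All.tabulate there)) least
    where
    least : ∀ {k} → k ∈ x ∷ xs → h (argmin h x xs) ≤ h k
    least (here refl) = f[argmin]≤f[⊤] {f = h} x xs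
    least (there k∈)  = All.lookup (f[argmin]≤f[xs] {f = h} x xs) k∈

Shatters : (X → Y → Set) → (ℕ → Y) → Set₁
Shatters {X} φ a = (I : ℕ → Set) → Σ X λ b → ∀ n → (φ b (a n) ⇔ I n)

module Shattering (φ : X → Y → Set) (a : ℕ → Y) where

  record IncreasingPair (c : Y × Y) : Set where
    constructor increasing
    field
      tail head : ℕ
      tail<head : tail < head
      pair≡     : c ≡ (a tail , a head)

  ∈-pairs-applyUpTo⁻ : ∀ {M c} → c ∈ pairs (applyUpTo a M) → IncreasingPair c
  ∈-pairs-applyUpTo⁻ {M} = All.lookup (All-pairs⁺ {R = λ y y′ → IncreasingPair (y , y′)}
    (applyUpTo⁺₁ a M λ i<j _ → increasing _ _ i<j refl))

  pq-property : Shatters φ a → ∀ d M → PQProperty (ψ-of φ) (d * d) d (pairs (applyUpTo a M))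
  pq-property shatter d M S S∈F = toSubset chosen , trans (∣toSubset∣ unique) length≡ , x , ψ-holds
    where
    open IncreasingPair
    ix : ∀ k → IncreasingPair (S k)
    ix k = ∈-pairs-applyUpTo⁻ {M} (S∈F k)
    open Intervals (tail ∘ ix) (head ∘ ix)
    open Choice (choose (tail<head ∘ ix) d (allFin (d * d)) (Unique.allFin⁺ (d * d))
                        (≤-reflexive (sym (length-tabulate id))))
    Tail : ℕ → Set
    Tail n = Any (λ m → n ≡ tail (ix m)) chosen
    x = proj₁ (shatter Tail)
    φx⇔Tail = proj₂ (shatter Tail)
    ψ-holds : ∀ k → k ∈ₛ toSubset chosen → ψ-of φ x (S k)
    ψ-holds k k∈I = subst (ψ-of φ x) (sym (pair≡ (ix k))) (φ-tail , ¬φ-head)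
      where
      k∈ = ∈-toSubset⁻ chosen k∈I
      φ-tail = Equivalence.from (φx⇔Tail _) (Any.map (cong (tail ∘ ix)) k∈)
      ¬φ-head : ¬ φ x (a (head (ix k)))
      ¬φ-head φxh with find (Equivalence.to (φx⇔Tail _) φxh)
      ... | m , m∈ , hk≡tm = nonabutting k∈ m∈ (sym hk≡tm)

mainTheorem3 : {X Y : Set} (φ : X → Y → Set) → ¬ NIP φ → ¬ Pierceable (ψ-of φ)
mainTheorem3 φ ¬nip (d , pierce) = ¬nip λ (a , _ , shatter) →
  let N , transversal = pierce (d * d) d (m≤m*m d) ≤-refl
      M = suc (2 ^ N)
  in Separation.no-small-transversal φ a N
       (transversal (pairs (applyUpTo a M)) (Shattering.pq-property φ a shatter d M))
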